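{- There exist Semi-BCI algebras $\langle A,\twoheadrightarrow,\rightarrow,\top\rangle$ whose relations $\ll$ and $\preceq$ coincide but which are not pseudo-BCI algebras, i.e. there is no binary relation $\leq$ on $A$ such that $\langle A,\leq,\twoheadrightarrow,\rightarrow,\top\rangle$ is a pseudo-BCI algebra.
   Context: A Semi-BCI (SBCI) algebra is a structure $\langle A,\twoheadrightarrow,\rightarrow,\top\rangle$ with two binary operations and $\top\in A$, where $x\ll y$ iff $x\twoheadrightarrow y=\top$ and $x\preceq y$ iff $x\rightarrow y=\top$, such that for all $x,y,z$: (S1) $x\twoheadrightarrow(y\twoheadrightarrow z)=y\twoheadrightarrow(x\twoheadrightarrow z)$; (S2) $x\rightarrow(y\rightarrow z)=y\rightarrow(x\rightarrow z)$; (S3) $x\twoheadrightarrow y\preceq(z\twoheadrightarrow x)\rightarrow(z\twoheadrightarrow y)$; (S4) $\top\twoheadrightarrow x=x$; (S5) if $x\ll y\preceq z$ then $x\ll z$; (S6) if $x\preceq y\ll z$ then $x\ll z$; (S7) if $x\preceq y$ and $y\preceq x$ then $x=y$. A pseudo-BCI algebra is a structure $\langle A,\leq,\mapsto,\rightsquigarrow,\top\rangle$ with $\leq$ a binary relation on $A$, $\mapsto,\rightsquigarrow$ binary operations and $\top\in A$ such that for all $x,y,z$: (P1) $x\mapsto y\leq(y\mapsto z)\rightsquigarrow(x\mapsto z)$; (P2) $x\rightsquigarrow y\leq(y\rightsquigarrow z)\mapsto(x\rightsquigarrow z)$; (P3) $x\leq(x\mapsto y)\rightsquigarrow y$; (P4)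 $x\leq(x\rightsquigarrow y)\mapsto y$; (P5) $x\leq x$; (P6) $x\leq y$ and $y\leq x$ imply $x=y$; (P7) $x\leq y$ iff $x\mapsto y=\top$ iff $x\rightsquigarrow y=\top$. In the claim, $\twoheadrightarrow$ plays the role of $\mapsto$ and $\rightarrow$ the role of $\rightsquigarrow$. -}

module Defs where

open import Level using (0ℓ)
open import Relation.Binary.PropositionalEquality using (_≡_)
open import Data.Product using (_×_; Σ; ∃)
open import Relation.Nullary using (¬_)

-- Semi-BCI algebra on carrier A with ↠ (twoheadrightarrow), → (written _⇒_), and ⊤ (top).
record IsSBCI (A : Set) (_↠_ : A → A → A) (_⇒_ : A → A → A) (⊤ : A) : Set where
  _≪_ : A → A → Set
  x ≪ y = (x ↠ y) ≡ ⊤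
  _⪯_ : A → A → Set
  x ⪯ y = (x ⇒ y) ≡ ⊤
  field
    S1 : ∀ x y z → (x ↠ (y ↠ z)) ≡ (y ↠ (x ↠ z))
    S2 : ∀ x y z → (x ⇒ (y ⇒ z)) ≡ (y ⇒ (x ⇒ z))
    S3 : ∀ x y z → (x ↠ y) ⪯ ((z ↠ x) ⇒ (z ↠ y))
    S4 : ∀ x → (⊤ ↠ x) ≡ x
    S5 : ∀ x y z → x ≪ y → y ⪯ z → x ≪ z
    S6 : ∀ x y z → x ⪯ y → y ≪ z → x ≪ z
    S7 : ∀ x y → x ⪯ y → y ⪯ x → x ≡ y

record IsPseudoBCI (A : Set) (_≤_ : A → A → Set) (_↦_ : A → A → A) (_⇝_ : A → A → A) (⊤ : A) : Set where
  field
    P1 : ∀ x y z → (x ↦ y) ≤ ((y ↦ z) ⇝ (x ↦ z))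
    P2 : ∀ x y z → (x ⇝ y) ≤ ((y ⇝ z) ↦ (x ⇝ z))
    P3 : ∀ x y → x ≤ ((x ↦ y) ⇝ y)
    P4 : ∀ x y → x ≤ ((x ⇝ y) ↦ y)
    P5 : ∀ x → x ≤ x
    P6 : ∀ x y → x ≤ y → y ≤ x → x ≡ y
    P7a : ∀ x y → x ≤ y → (x ↦ y) ≡ ⊤
    P7b : ∀ x y → (x ↦ y) ≡ ⊤ → x ≤ y
    P7c : ∀ x y → x ≤ y → (x ⇝ y) ≡ ⊤
    P7d : ∀ x y → (x ⇝ y) ≡ ⊤ → x ≤ y

module Submission where

-- In every pseudo-BCI algebra, P4 (x ≤ (x ⇝ y) ↦ y) together
-- with P7 gives the identity  x ↦ ((x ⇝ y) ↦ y) = ⊤.  So a structure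
-- violating this identity admits no pseudo-BCI order at all.
--
-- On E = {a, b, t} take the chain a ⊑ b ⊑ t and the family of
-- implications  impl c  (c ∈ E): x ⇀ y = t when x ⊑ y, t ⇀ y = y, and the
-- single remaining entry b ⇀ a = c.  With ↠ = impl a and ⇒ = impl b,
-- for c ≠ t one has  impl c x y = t ⇔ x ⊑ y,  so ≪ and ⪯ are both ⊑;
-- S5–S7 are then transitivity and antisymmetry of ⊑, while the identities
-- S1–S4 are finite checks decided by enumerating E.  Finally
-- b ↠ ((b ⇒ a) ↠ a) = b ↠ (b ↠ a) = b ↠ a = a ≠ t, so the obstruction applies.

open import Defs
open import Relation.Binary.PropositionalEquality using (_≡_; _≢_; refl)
open import Relation.Binary.Definitions using (DecidableEquality)
open import Data.Product using (Σ; _×_; _,_; ∃₂)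
open import Relation.Nullary using (¬_; Dec; yes; no)
open import Relation.Nullary.Decidable using (map′; _×-dec_; toWitness)
open import Function.Bundles using (_⇔_; mk⇔; module Equivalence)
import Function.Properties.Equivalence as ⇔

pseudoBCI-P4-identity : ∀ {A : Set} {_≤_ : A → A → Set} {_↦_ _⇝_ : A → A → A} {⊤ : A} →
  IsPseudoBCI A _≤_ _↦_ _⇝_ ⊤ → ∀ x y → (x ↦ ((x ⇝ y) ↦ y)) ≡ ⊤
pseudoBCI-P4-identity p x y = P7a x _ (P4 x y)
  where open IsPseudoBCI p

no-pseudoBCI-order : ∀ {A : Set} {_↦_ _⇝_ : A → A → A} {⊤ : A} →
  ∃₂ (λ x y → (x ↦ ((x ⇝ y) ↦ y)) ≢ ⊤) →
  ¬ (Σ (A → A → Set) λ _≤_ → IsPseudoBCI A _≤_ _↦_ _⇝_ ⊤)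
no-pseudoBCI-order (x , y , fails) (_ , p) = fails (pseudoBCI-P4-identity p x y)

data E : Set where
  t a b : E

_≟_ : DecidableEquality E
t ≟ t = yes refl
a ≟ a = yes refl
b ≟ b = yes refl
t ≟ a = no λ ()
t ≟ b = no λ ()
a ≟ t = no λ ()
a ≟ b = no λ ()
b ≟ t = no λ ()
b ≟ a = no λ ()

∀? : {P : E → Set} → (∀ x → Dec (P x)) → Dec (∀ x → P x)
∀? P? = map′ (λ { (pt , pa , pb) → λ { t → pt ; a → pa ; b → pb } })
             (λ all → all t , all a , all b)
             (P? t ×-dec P? a ×-dec P? b)

data _⊑_ : E → E → Set where
  ⊑-refl : ∀ {x} → x ⊑ x
  ⊑-top  : ∀ {x} → x ⊑ t
  a⊑b    : a ⊑ b

⊑-trans : ∀ {x y z} → x ⊑ y → y ⊑ z → x ⊑ z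
⊑-trans ⊑-refl q      = q
⊑-trans p      ⊑-refl = p
⊑-trans _      ⊑-top  = ⊑-top

⊑-antisym : ∀ {x y} → x ⊑ y → y ⊑ x → x ≡ y
⊑-antisym ⊑-refl _      = refl
⊑-antisym _      ⊑-refl = refl
⊑-antisym ⊑-top  ⊑-top  = refl

impl : E → E → E → E
impl c t y = y
impl c a y = t
impl c b t = t
impl c b a = c
impl c b b = t

impl-top⇔⊑ : ∀ {c} → c ≢ t → ∀ x y → (impl c x y ≡ t) ⇔ (x ⊑ y)
impl-top⇔⊑ c≢t x y = mk⇔ (to x y) (from x y)
  where
  to : ∀ x y → impl _ x y ≡ t → x ⊑ y
  to t t _ = ⊑-refl
  to a t _ = ⊑-top
  to a a _ = ⊑-refl
  to a b _ = a⊑b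
  to b t _ = ⊑-top
  to b a c≡t with () ← c≢t c≡t
  to b b _ = ⊑-refl
  from : ∀ x y → x ⊑ y → impl _ x y ≡ t
  from t t _ = refl
  from a _ _ = refl
  from b t _ = refl
  from b b _ = refl

_↠_ _⇒_ : E → E → E
_↠_ = impl a
_⇒_ = impl b

↠-top⇔⊑ : ∀ x y → ((x ↠ y) ≡ t) ⇔ (x ⊑ y)
↠-top⇔⊑ = impl-top⇔⊑ λ ()

⇒-top⇔⊑ : ∀ x y → ((x ⇒ y) ≡ t) ⇔ (x ⊑ y)
⇒-top⇔⊑ = impl-top⇔⊑ λ ()

sbci : IsSBCI E _↠_ _⇒_ t
sbci = record
  { S1 = toWitness {a? = ∀? λ x → ∀? λ y → ∀? λ z → (x ↠ (y ↠ z)) ≟ (y ↠ (x ↠ z))} _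
  ; S2 = toWitness {a? = ∀? λ x → ∀? λ y → ∀? λ z → (x ⇒ (y ⇒ z)) ≟ (y ⇒ (x ⇒ z))} _
  ; S3 = toWitness {a? = ∀? λ x → ∀? λ y → ∀? λ z → ((x ↠ y) ⇒ ((z ↠ x) ⇒ (z ↠ y))) ≟ t} _
  ; S4 = toWitness {a? = ∀? λ x → (t ↠ x) ≟ x} _
  ; S5 = λ x y z x≪y y⪯z → ⊑⇒≪ x z (⊑-trans (≪⇒⊑ x y x≪y) (⪯⇒⊑ y z y⪯z))
  ; S6 = λ x y z x⪯y y≪z → ⊑⇒≪ x z (⊑-trans (⪯⇒⊑ x y x⪯y) (≪⇒⊑ y z y≪z))
  ; S7 = λ x y x⪯y y⪯x → ⊑-antisym (⪯⇒⊑ x y x⪯y) (⪯⇒⊑ y x y⪯x)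
  }
  where
  ≪⇒⊑ : ∀ x y → (x ↠ y) ≡ t → x ⊑ y
  ≪⇒⊑ x y = Equivalence.to (↠-top⇔⊑ x y)
  ⊑⇒≪ : ∀ x y → x ⊑ y → (x ↠ y) ≡ t
  ⊑⇒≪ x y = Equivalence.from (↠-top⇔⊑ x y)
  ⪯⇒⊑ : ∀ x y → (x ⇒ y) ≡ t → x ⊑ y
  ⪯⇒⊑ x y = Equivalence.to (⇒-top⇔⊑ x y)

proposition15 : Σ Set λ A → Σ (A → A → A) λ _↠_ → Σ (A → A → A) λ _⇒_ → Σ A λ ⊤ →
    IsSBCI A _↠_ _⇒_ ⊤
    × (∀ x y → ((x ↠ y) ≡ ⊤) ⇔ ((x ⇒ y) ≡ ⊤))
    × ¬ (Σ (A → A → Set) λ _≤_ → IsPseudoBCI A _≤_ _↠_ _⇒_ ⊤)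
proposition15 =
  E , _↠_ , _⇒_ , t , sbci ,
  (λ x y → ⇔.trans (↠-top⇔⊑ x y) (⇔.sym (⇒-top⇔⊑ x y))) ,
  -- b ↠ ((b ⇒ a) ↠ a) evaluates to a, which is not t.
  no-pseudoBCI-order (b , a , λ ())
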